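{- Let $n\ge0$ and $\tau\in Y_n$. Then $\tau$ splits if and only if $\tau\in Y^{be}\cup Y^{bo}$. In particular, for every $n\ge0$, $$\varphi(Y^{be}_{2n})=\{P\in\mathrm{NCP}_{2n}\mid P=Q_1\cup Q_2,\ Q_1,Q_2\in\mathrm{NCP}_n\}.$$
   Context: Planar binary trees: $Y_0=\{|\}$, $Y_n=\{\sigma\vee\tau:\sigma\in Y_k,\tau\in Y_l,k+l=n-1\}$ for $n\ge1$, where $\sigma\vee\tau$ is the tree whose root has left subtree $\sigma$ and right subtree $\tau$. Vertices of $\tau\in Y_n$ are numbered $1,\dots,n$ in left-to-right (in-order) order: left subtree, then root, then right subtree. A right arm is an equivalence class of vertices under the equivalence relation generated by "$x$ is the right child of $y$". A tree splits if in each right arm all vertices have numbers of the same parity. $Y^{be}_0=\{|\}$; for $n\ge0$, $Y^{bo}_{2n+1}=\{\tau_1\vee\tau_2:\tau_i\in Y^{be}_{2k_i},k_1+k_2=n\}$; for $n\ge1$, $Y^{be}_{2n}=\{\tau_1\vee\tau_2:\tau_1\in Y^{bo}_{2k_1+1},\tau_2\in Y^{be}_{2k_2},k_1+k_2=n-1\}$; $Y^{be}=\bigcup_nY^{be}_{2n}$, $Y^{bo}=\bigcup_nY^{bo}_{2n+1}$. Noncrossing partitions: $\mathrm{NCP}_n$ noncrossing partitions of $[n]$, $\mathrm{NCP}_0=\{\emptyset\}$, $|$ the unique element of $\mathrm{NCP}_1$; $P*Q$ concatenation (blocks of $Q\in\mathrm{NCP}_n$ shifted by $m$ for $P\in\mathrm{NCP}_m$);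 $P\,\underline*\,Q$ is $P*Q$ with the block containing $m$ merged with the block containing $m+n$ ($=P*Q$ if $P$ or $Q$ is empty). $\varphi:\bigcup_nY_n\to\bigcup_n\mathrm{NCP}_n$: $\varphi(|)=\emptyset$, $\varphi(\sigma\vee\tau)=\varphi(\sigma)*(|\,\underline*\,\varphi(\tau))$ (equivalently, $\varphi(\tau)$ is the partition of $[n]$ into right arms). For $Q_1,Q_2\in\mathrm{NCP}_n$, $Q_1\cup Q_2$ is the partition of $[2n]$ with blocks $\{2i-1:i\in V\}$, $V\in Q_1$, and $\{2i:i\in W\}$, $W\in Q_2$. -}

module Defs where

open import Data.Nat using (ℕ; zero; suc; _+_; _*_; _∸_; _≤_; _<_; _≡ᵇ_)
open import Data.Bool using (if_then_else_)
open import Data.List using (List; []; _∷_; _++_; map; length; concat; zipWith; last)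
open import Data.List.Relation.Unary.All using (All)
open import Data.Maybe using (just; nothing)
open import Data.Product using (_×_; _,_; proj₁; proj₂)
open import Data.Sum using (_⊎_)
open import Data.Nat.DivMod using (_%_)
open import Relation.Binary.PropositionalEquality using (_≡_)

-- Planar binary trees.  leaf = |, node σ τ = σ ∨ τ.
-- τ ∈ Y_n  means  size τ ≡ n.

data Tree : Set where
  leaf : Tree
  node : Tree → Tree → Tree

size : Tree → ℕ
size leaf       = 0
size (node s t) = suc (size s + size t)

-- Vertices are numbered in-order; in a subtree whose
-- vertices are numbered o+1, …, o+size, the root of node σ τ has
-- number o + size σ + 1.
-- armsP t o = (the right arm through the root of t (empty if t = leaf),
--              list of all other right arms of t).

mutual
  armsP : Tree → ℕ → List ℕ × List (List ℕ)
  armsP leaf       o = [] , []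
  armsP (node s t) o =
    let r = o + size s + 1 in
    (r ∷ proj₁ (armsP t r)) , (allArms s o ++ proj₂ (armsP t r))

  -- all right arms of t (possibly with an extra empty arm, which is
  -- irrelevant for parity conditions)
  allArms : Tree → ℕ → List (List ℕ)
  allArms t o = proj₁ (armsP t o) ∷ proj₂ (armsP t o)

rightArms : Tree → List (List ℕ)
rightArms t = allArms t 0

Even Odd : ℕ → Set
Even x = x % 2 ≡ 0
Odd x = x % 2 ≡ 1

SameParity : List ℕ → Set
SameParity xs = All Even xs ⊎ All Odd xs

Splits : Tree → Set
Splits t = All SameParity (rightArms t)

-- Y^be and Y^bo.
-- Ybe k t  means  t ∈ Y^be_{2k};   Ybo k t  means  t ∈ Y^bo_{2k+1}.

mutual
  data Ybe : ℕ → Tree → Set where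
    be-leaf : Ybe 0 leaf
    be-node : ∀ {k₁ k₂ t₁ t₂} → Ybo k₁ t₁ → Ybe k₂ t₂ →
              Ybe (suc (k₁ + k₂)) (node t₁ t₂)

  data Ybo : ℕ → Tree → Set where
    bo-node : ∀ {k₁ k₂ t₁ t₂} → Ybe k₁ t₁ → Ybe k₂ t₂ →
              Ybo (k₁ + k₂) (node t₁ t₂)

-- Set partitions of [n] = {1,…,n} encoded canonically as a list of
-- length n whose i-th entry (1-based) is the minimum of the block
-- containing i.  Two partitions are equal iff their encodings are ≡.

-- 1-based lookup (0 outside the range)
at : List ℕ → ℕ → ℕ
at []       _             = 0
at (x ∷ xs) zero          = 0
at (x ∷ xs) (suc zero)    = x
at (x ∷ xs) (suc (suc i)) = at xs (suc i)

SameBlock : List ℕ → ℕ → ℕ → Set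
SameBlock P i j = at P i ≡ at P j

IsPartition : ℕ → List ℕ → Set
IsPartition n P =
  length P ≡ n ×
  (∀ i → 1 ≤ i → i ≤ n → 1 ≤ at P i × at P i ≤ i × at P (at P i) ≡ at P i)

NonCrossing : ℕ → List ℕ → Set
NonCrossing n P =
  ∀ a b c d → 1 ≤ a → a < b → b < c → c < d → d ≤ n →
  SameBlock P a c → SameBlock P b d → SameBlock P a b

IsNCP : ℕ → List ℕ → Set
IsNCP n P = IsPartition n P × NonCrossing n P

_⋆_ : List ℕ → List ℕ → List ℕ
P ⋆ Q = P ++ map (length P +_) Q

-- P ⋆̲ Q : P * Q with the block of m merged with the block of m+n
_⋆̲_ : List ℕ → List ℕ → List ℕ
P ⋆̲ Q with last P | last (P ⋆ Q)
... | just a | just b with Q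
...   | []    = P ⋆ Q
...   | _ ∷ _ = map (λ x → if x ≡ᵇ b then a else x) (P ⋆ Q)
P ⋆̲ Q | _ | _ = P ⋆ Q

bar : List ℕ
bar = 1 ∷ []

φ : Tree → List ℕ
φ leaf       = []
φ (node s t) = φ s ⋆ (bar ⋆̲ φ t)

-- Q₁ ∪ Q₂ : odd positions carry Q₁, even positions carry Q₂
_∪ₚ_ : List ℕ → List ℕ → List ℕ
Q₁ ∪ₚ Q₂ = concat (zipWith (λ a b → (2 * a ∸ 1) ∷ (2 * b) ∷ []) Q₁ Q₂)

{-# OPTIONS --safe #-}
module Submission where

-- Consecutive vertices of a right arm differ by one more than the size of the left
-- subtree between them, so τ splits iff all left subtrees hanging off right arms below
-- their tops are odd; this is the recursive description of Y^be ∪ Y^bo, which can also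
-- be put as: s ∨ t ∈ Y^be ∪ Y^bo iff s, t ∈ Y^be ∪ Y^bo and |t| is even.
--
-- The blocks of φ (s ∨ t) = φ s * (| *̲ φ t) are those of φ s, and those of φ t shifted
-- by |s| + 1, the root joining the block of the last vertex of t.  Hence φ τ is a
-- noncrossing partition, and its blocks have constant parity iff |t| is even at every
-- node, i.e. iff τ ∈ Y^be ∪ Y^bo.  Conversely every noncrossing partition is some φ τ
-- (cut [1, n] at the first element of the block of n).  Finally, a partition of [2n]
-- whose blocks have constant parity is Q₁ ∪ Q₂ for its restrictions Q₁, Q₂ to the odd
-- and to the even positions, which are noncrossing if it is.

open import Defs
open import Data.Bool using (true; false; if_then_else_)
open import Data.Bool.Properties using (if-eta)
open import Data.Empty using (⊥; ⊥-elim)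
open import Data.List using (List; []; _∷_; _++_; map; length; last; applyUpTo)
open import Data.List.Properties using (length-map; length-++; length-applyUpTo; map-∘)
open import Data.List.Relation.Unary.All using (All; []; _∷_)
open import Data.List.Relation.Unary.All.Properties using (++⁺; ++⁻)
open import Data.Maybe using (just)
open import Data.Nat using (ℕ; zero; suc; _+_; _*_; _∸_; _≤_; _≰_; _<_; _≡ᵇ_; z≤n; s≤s; parity; _≟_; _≤?_; ⌊_/2⌋)
open import Data.Nat.Induction using (<-rec)
open import Data.Nat.Properties
open import Algebra.Properties.CommutativeSemigroup +-commutativeSemigroup using (interchange)
open import Data.Parity.Base using (0ℙ; 1ℙ) renaming (_+_ to _+ℙ_)
import Data.Parity.Properties as ℙ
open import Data.Product using (_×_; _,_; proj₁; proj₂; ∃-syntax)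
open import Data.Product.Function.NonDependent.Propositional using (_×-⇔_)
open import Data.Sum using (_⊎_; inj₁; inj₂)
open import Data.Unit using (⊤; tt)
open import Function.Base using (_∘_)
open import Function.Bundles using (_⇔_; mk⇔; Equivalence)
import Function.Properties.Equivalence as ⇔
open import Relation.Binary.Definitions using (tri<; tri≈; tri>)
open import Relation.Binary.PropositionalEquality
open import Relation.Nullary using (contradiction; proof; yes; no)
open import Relation.Nullary.Reflects using (Reflects; ofʸ; ofⁿ)

open Equivalence using (to; from)

-- Right arms and Y^be ∪ Y^bo

even⇔parity≡0ℙ : ∀ n → Even n ⇔ parity n ≡ 0ℙ
even⇔parity≡0ℙ 0             = mk⇔ (λ _ → refl) (λ _ → refl)
even⇔parity≡0ℙ 1             = mk⇔ (λ ()) (λ ())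
even⇔parity≡0ℙ (suc (suc n)) = even⇔parity≡0ℙ n

odd⇔parity≡1ℙ : ∀ n → Odd n ⇔ parity n ≡ 1ℙ
odd⇔parity≡1ℙ 0             = mk⇔ (λ ()) (λ ())
odd⇔parity≡1ℙ 1             = mk⇔ (λ _ → refl) (λ _ → refl)
odd⇔parity≡1ℙ (suc (suc n)) = odd⇔parity≡1ℙ n

sameParity-singleton : ∀ x → SameParity (x ∷ [])
sameParity-singleton x with parity x in eq
... | 0ℙ = inj₁ (from (even⇔parity≡0ℙ x) eq ∷ [])
... | 1ℙ = inj₂ (from (odd⇔parity≡1ℙ x) eq ∷ [])

sameParity-∷∷ : ∀ x y ys → SameParity (x ∷ y ∷ ys) ⇔ (parity x ≡ parity y × SameParity (y ∷ ys))
sameParity-∷∷ x y ys = mk⇔ split join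
  where
  split : SameParity (x ∷ y ∷ ys) → parity x ≡ parity y × SameParity (y ∷ ys)
  split (inj₁ (ex ∷ ey ∷ es)) =
    trans (to (even⇔parity≡0ℙ x) ex) (sym (to (even⇔parity≡0ℙ y) ey)) , inj₁ (ey ∷ es)
  split (inj₂ (ox ∷ oy ∷ os)) =
    trans (to (odd⇔parity≡1ℙ x) ox) (sym (to (odd⇔parity≡1ℙ y) oy)) , inj₂ (oy ∷ os)

  join : parity x ≡ parity y × SameParity (y ∷ ys) → SameParity (x ∷ y ∷ ys)
  join (xy , inj₁ (ey ∷ es)) =
    inj₁ (from (even⇔parity≡0ℙ x) (trans xy (to (even⇔parity≡0ℙ y) ey)) ∷ ey ∷ es)
  join (xy , inj₂ (oy ∷ os)) =
    inj₂ (from (odd⇔parity≡1ℙ x) (trans xy (to (odd⇔parity≡1ℙ y) oy)) ∷ oy ∷ os)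

parity-double : ∀ k → parity (k + k) ≡ 0ℙ
parity-double k = trans (ℙ.+-homo-+ k k) (ℙ.p+p≡0ℙ (parity k))

parity-1+double : ∀ k → parity (suc (k + k)) ≡ 1ℙ
parity-1+double k = trans (ℙ.+-homo-+ 1 (k + k)) (cong (1ℙ +ℙ_) (parity-double k))

parity≡parity[+1+]⇔odd : ∀ o s → parity o ≡ parity (o + s + 1) ⇔ parity s ≡ 1ℙ
parity≡parity[+1+]⇔odd o s rewrite ℙ.+-homo-+ (o + s) 1 | ℙ.+-homo-+ o s with parity o | parity s
... | 0ℙ | 0ℙ = mk⇔ (λ ()) (λ ())
... | 0ℙ | 1ℙ = mk⇔ (λ _ → refl) (λ _ → refl)
... | 1ℙ | 0ℙ = mk⇔ (λ ()) (λ ())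
... | 1ℙ | 1ℙ = mk⇔ (λ _ → refl) (λ _ → refl)

parity-+ˡ : ∀ m {x y} → parity (m + x) ≡ parity (m + y) ⇔ parity x ≡ parity y
parity-+ˡ m {x} {y} = mk⇔
  (λ e → ℙ.+-cancelˡ-≡ (parity m) _ _ (trans (sym (ℙ.+-homo-+ m x)) (trans e (ℙ.+-homo-+ m y))))
  (λ e → trans (ℙ.+-homo-+ m x) (trans (cong (parity m +ℙ_) e) (sym (ℙ.+-homo-+ m y))))

armFrom : Tree → ℕ → List ℕ
armFrom t r = r ∷ proj₁ (armsP t r)

mutual
  LocallySplits : Tree → Set
  LocallySplits leaf       = ⊤
  LocallySplits (node s t) = LocallySplits s × OddArm t

  OddArm : Tree → Set
  OddArm leaf       = ⊤
  OddArm (node a b) = LocallySplits a × parity (size a) ≡ 1ℙ × OddArm b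

mutual
  allArms⇒locallySplits : ∀ t o → All SameParity (allArms t o) → LocallySplits t
  allArms⇒locallySplits leaf       o _            = tt
  allArms⇒locallySplits (node s t) o (arm ∷ rest) =
    let left , below = ++⁻ (allArms s o) rest in
    allArms⇒locallySplits s o left , armFrom⇒oddArm t _ arm below

  armFrom⇒oddArm : ∀ t r → SameParity (armFrom t r) → All SameParity (proj₂ (armsP t r)) → OddArm t
  armFrom⇒oddArm leaf       r _   _    = tt
  armFrom⇒oddArm (node a b) r arm rest =
    let step , arm-below = to (sameParity-∷∷ _ _ _) arm
        left , below     = ++⁻ (allArms a r) rest in
    allArms⇒locallySplits a r left ,
    to (parity≡parity[+1+]⇔odd r (size a)) step ,
    armFrom⇒oddArm b _ arm-below below

mutual
  locallySplits⇒allArms : ∀ t o → LocallySplits t → All SameParity (allArms t o)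
  locallySplits⇒allArms leaf       o _          = inj₁ [] ∷ []
  locallySplits⇒allArms (node s t) o (ls , odd) =
    let arm , below = oddArm⇒armFrom t _ odd in
    arm ∷ ++⁺ (locallySplits⇒allArms s o ls) below

  oddArm⇒armFrom : ∀ t r → OddArm t → SameParity (armFrom t r) × All SameParity (proj₂ (armsP t r))
  oddArm⇒armFrom leaf       r _               = sameParity-singleton r , []
  oddArm⇒armFrom (node a b) r (ls , odd , oa) =
    let arm , below = oddArm⇒armFrom b _ oa in
    from (sameParity-∷∷ _ _ _) (from (parity≡parity[+1+]⇔odd r (size a)) odd , arm) ,
    ++⁺ (locallySplits⇒allArms a r ls) below

splits⇔locallySplits : ∀ t → Splits t ⇔ LocallySplits t
splits⇔locallySplits t = mk⇔ (allArms⇒locallySplits t 0) (locallySplits⇒allArms t 0)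

Yb : Tree → Set
Yb t = (∃[ k ] Ybe k t) ⊎ (∃[ k ] Ybo k t)

mutual
  size-Ybe : ∀ {k t} → Ybe k t → size t ≡ k + k
  size-Ybe be-leaf = refl
  size-Ybe (be-node {k₁} {k₂} {t₁} {t₂} o e) = cong suc (begin
    size t₁ + size t₂          ≡⟨ cong₂ _+_ (size-Ybo o) (size-Ybe e) ⟩
    suc (k₁ + k₁ + (k₂ + k₂))  ≡⟨ cong suc (interchange k₁ k₁ k₂ k₂) ⟩
    suc (k₁ + k₂ + (k₁ + k₂))  ≡⟨ +-suc (k₁ + k₂) (k₁ + k₂) ⟨
    k₁ + k₂ + suc (k₁ + k₂)    ∎)
    where open ≡-Reasoning

  size-Ybo : ∀ {k t} → Ybo k t → size t ≡ suc (k + k)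
  size-Ybo (bo-node {k₁} {k₂} e₁ e₂) =
    cong suc (trans (cong₂ _+_ (size-Ybe e₁) (size-Ybe e₂)) (interchange k₁ k₁ k₂ k₂))

parity-Ybe : ∀ {k t} → Ybe k t → parity (size t) ≡ 0ℙ
parity-Ybe {k} e = trans (cong parity (size-Ybe e)) (parity-double k)

parity-Ybo : ∀ {k t} → Ybo k t → parity (size t) ≡ 1ℙ
parity-Ybo {k} o = trans (cong parity (size-Ybo o)) (parity-1+double k)

mutual
  locallySplits⇒Yb : ∀ t → LocallySplits t → Yb t
  locallySplits⇒Yb leaf       _          = inj₁ (0 , be-leaf)
  locallySplits⇒Yb (node s t) (ls , oa) with locallySplits⇒Yb s ls | oddArm⇒Ybe t oa
  ... | inj₁ (_ , e) | _ , e₂ = inj₂ (_ , bo-node e e₂)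
  ... | inj₂ (_ , o) | _ , e₂ = inj₁ (_ , be-node o e₂)

  oddArm⇒Ybe : ∀ t → OddArm t → ∃[ k ] Ybe k t
  oddArm⇒Ybe leaf       _               = 0 , be-leaf
  oddArm⇒Ybe (node a b) (ls , odd , oa) with locallySplits⇒Yb a ls | oddArm⇒Ybe b oa
  ... | inj₁ (_ , e) | _      = contradiction (trans (sym (parity-Ybe e)) odd) (ℙ.p≢p⁻¹ 0ℙ)
  ... | inj₂ (_ , o) | _ , e₂ = _ , be-node o e₂

mutual
  Ybe⇒locallySplits : ∀ {k t} → Ybe k t → LocallySplits t
  Ybe⇒locallySplits be-leaf      = tt
  Ybe⇒locallySplits (be-node o e) = Ybo⇒locallySplits o , Ybe⇒oddArm e

  Ybo⇒locallySplits : ∀ {k t} → Ybo k t → LocallySplits t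
  Ybo⇒locallySplits (bo-node e₁ e₂) = Ybe⇒locallySplits e₁ , Ybe⇒oddArm e₂

  Ybe⇒oddArm : ∀ {k t} → Ybe k t → OddArm t
  Ybe⇒oddArm be-leaf       = tt
  Ybe⇒oddArm (be-node o e) = Ybo⇒locallySplits o , parity-Ybo o , Ybe⇒oddArm e

locallySplits⇔Yb : ∀ t → LocallySplits t ⇔ Yb t
locallySplits⇔Yb t = mk⇔ (locallySplits⇒Yb t) from-Yb
  where
  from-Yb : Yb t → LocallySplits t
  from-Yb (inj₁ (_ , e)) = Ybe⇒locallySplits e
  from-Yb (inj₂ (_ , o)) = Ybo⇒locallySplits o

splits⇔Yb : ∀ t → Splits t ⇔ Yb t
splits⇔Yb t = ⇔.trans (splits⇔locallySplits t) (locallySplits⇔Yb t)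

Yb-node : ∀ s t → Yb (node s t) ⇔ (Yb s × Yb t × parity (size t) ≡ 0ℙ)
Yb-node s t = mk⇔ split join
  where
  split : Yb (node s t) → Yb s × Yb t × parity (size t) ≡ 0ℙ
  split (inj₁ (_ , be-node o e))   = inj₂ (_ , o) , inj₁ (_ , e) , parity-Ybe e
  split (inj₂ (_ , bo-node e₁ e₂)) = inj₁ (_ , e₁) , inj₁ (_ , e₂) , parity-Ybe e₂

  join : Yb s × Yb t × parity (size t) ≡ 0ℙ → Yb (node s t)
  join (_ , inj₂ (_ , o) , even) = contradiction (trans (sym even) (parity-Ybo o)) (ℙ.p≢p⁻¹ 0ℙ)
  join (inj₁ (_ , e₁) , inj₁ (_ , e₂) , _) = inj₂ (_ , bo-node e₁ e₂)
  join (inj₂ (_ , o₁) , inj₁ (_ , e₂) , _) = inj₁ (_ , be-node o₁ e₂)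

-- Labellings and partitions

-- A labelling f of the positions 1, …, m has the fibres of f as blocks; IsPartition and
-- NonCrossing of Defs are CanonicalOn and NonCrossingOn for the labelling at P.

CanonicalOn : ℕ → (ℕ → ℕ) → Set
CanonicalOn m f = ∀ i → 1 ≤ i → i ≤ m → 1 ≤ f i × f i ≤ i × f (f i) ≡ f i

NonCrossingOn : ℕ → (ℕ → ℕ) → Set
NonCrossingOn m f =
  ∀ a b c d → 1 ≤ a → a < b → b < c → c < d → d ≤ m → f a ≡ f c → f b ≡ f d → f a ≡ f b

SameKernelOn : ℕ → (ℕ → ℕ) → (ℕ → ℕ) → Set
SameKernelOn m f g = ∀ x y → 1 ≤ x → x ≤ m → 1 ≤ y → y ≤ m → (f x ≡ f y) ⇔ (g x ≡ g y)

ParitySplitOn : ℕ → (ℕ → ℕ) → Set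
ParitySplitOn m f = ∀ x y → 1 ≤ x → x ≤ m → 1 ≤ y → y ≤ m → f x ≡ f y → parity x ≡ parity y

≡-sym⇔ : ∀ {a b : ℕ} → (a ≡ b) ⇔ (b ≡ a)
≡-sym⇔ = mk⇔ sym sym

module _ {m : ℕ} {f g : ℕ → ℕ} where

  sameKernel-sym : SameKernelOn m f g → SameKernelOn m g f
  sameKernel-sym k x y px xm py ym = ⇔.sym (k x y px xm py ym)

  sameKernel-trans : ∀ {h} → SameKernelOn m f g → SameKernelOn m g h → SameKernelOn m f h
  sameKernel-trans k l x y px xm py ym = ⇔.trans (k x y px xm py ym) (l x y px xm py ym)

  nonCrossing-transfer : SameKernelOn m f g → NonCrossingOn m f → NonCrossingOn m g
  nonCrossing-transfer k nc a b c d 1≤a a<b b<c c<d d≤m gac gbd =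
    to (k a b 1≤a a≤m 1≤b b≤m) (nc a b c d 1≤a a<b b<c c<d d≤m
      (from (k a c 1≤a a≤m 1≤c c≤m) gac) (from (k b d 1≤b b≤m 1≤d d≤m) gbd))
    where
    1≤b = ≤-trans 1≤a (<⇒≤ a<b)
    1≤c = ≤-trans 1≤b (<⇒≤ b<c)
    1≤d = ≤-trans 1≤c (<⇒≤ c<d)
    c≤m = ≤-trans (<⇒≤ c<d) d≤m
    b≤m = ≤-trans (<⇒≤ b<c) c≤m
    a≤m = ≤-trans (<⇒≤ a<b) b≤m

  paritySplit-transfer : SameKernelOn m f g → ParitySplitOn m f → ParitySplitOn m g
  paritySplit-transfer k ps x y px xm py ym gxy = ps x y px xm py ym (from (k x y px xm py ym) gxy)

  canonical-unique : CanonicalOn m f → CanonicalOn m g → SameKernelOn m f g →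
                     ∀ i → 1 ≤ i → i ≤ m → f i ≡ g i
  canonical-unique cf cg k i 1≤i i≤m = ≤-antisym (below cf cg k) (below cg cf (sameKernel-sym k))
    where
    -- f i = f (g i) because g i lies in the block of i, and f (g i) ≤ g i.
    below : ∀ {f g} → CanonicalOn m f → CanonicalOn m g → SameKernelOn m f g → f i ≤ g i
    below {f} {g} cf cg k =
      let 1≤gi , gi≤i , ggi = cg i 1≤i i≤m
          gi≤m = ≤-trans gi≤i i≤m
      in subst (_≤ g i) (from (k (g i) i 1≤gi gi≤m 1≤i i≤m) ggi) (proj₁ (proj₂ (cf (g i) 1≤gi gi≤m)))

nonCrossing-∘ : ∀ {m n f} (e : ℕ → ℕ) → (∀ {x y} → x < y → e x < e y) →
                (∀ {x} → 1 ≤ x → 1 ≤ e x) → (∀ {x} → x ≤ n → e x ≤ m) →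
                NonCrossingOn m f → NonCrossingOn n (f ∘ e)
nonCrossing-∘ e mono pos bound nc a b c d 1≤a a<b b<c c<d d≤n =
  nc (e a) (e b) (e c) (e d) (pos 1≤a) (mono a<b) (mono b<c) (mono c<d) (bound d≤n)

at-ext : ∀ P Q → length P ≡ length Q → (∀ i → 1 ≤ i → i ≤ length P → at P i ≡ at Q i) → P ≡ Q
at-ext []      []      _   _  = refl
at-ext (x ∷ P) (y ∷ Q) len eq = cong₂ _∷_ (eq 1 ≤-refl (s≤s z≤n))
  (at-ext P Q (suc-injective len) (λ { (suc i) _ i≤ → eq (suc (suc i)) (s≤s z≤n) (s≤s i≤) }))

partition-unique : ∀ {m P Q} → IsPartition m P → IsPartition m Q → SameKernelOn m (at P) (at Q) → P ≡ Q
partition-unique {P = P} {Q} (lenP , cP) (lenQ , cQ) k =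
  at-ext P Q (trans lenP (sym lenQ)) (λ i 1≤i i≤ → canonical-unique cP cQ k i 1≤i (subst (i ≤_) lenP i≤))

at-map : ∀ (g : ℕ → ℕ) P j → j < length P → at (map g P) (suc j) ≡ g (at P (suc j))
at-map g (x ∷ P) zero    _         = refl
at-map g (x ∷ P) (suc j) (s≤s j<) = at-map g P j j<

at-++ˡ : ∀ P Q j → j < length P → at (P ++ Q) (suc j) ≡ at P (suc j)
at-++ˡ (x ∷ P) Q zero    _         = refl
at-++ˡ (x ∷ P) Q (suc j) (s≤s j<) = at-++ˡ P Q j j<

at-++ʳ : ∀ P Q j → at (P ++ Q) (suc (length P + j)) ≡ at Q (suc j)
at-++ʳ []      Q j = refl
at-++ʳ (x ∷ P) Q j = at-++ʳ P Q j

at-applyUpTo : ∀ (g : ℕ → ℕ) n j → j < n → at (applyUpTo g n) (suc j) ≡ g j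
at-applyUpTo g (suc n) zero    _         = refl
at-applyUpTo g (suc n) (suc j) (s≤s j<) = at-applyUpTo (g ∘ suc) n j j<

≡ᵇ-reflects : ∀ x y → Reflects (x ≡ y) (x ≡ᵇ y)
≡ᵇ-reflects x y = proof (x ≟ y)

-- The least y ∈ [1, n] with f y ≡ v, or 1 + n if there is none.
firstPos : (ℕ → ℕ) → ℕ → ℕ → ℕ
firstPos f v zero    = 1
firstPos f v (suc n) = if f 1 ≡ᵇ v then 1 else suc (firstPos (f ∘ suc) v n)

1≤firstPos : ∀ f v n → 1 ≤ firstPos f v n
1≤firstPos f v zero    = ≤-refl
1≤firstPos f v (suc n) with f 1 ≡ᵇ v
... | true  = ≤-refl
... | false = s≤s z≤n

firstPos-least : ∀ f v n y → 1 ≤ y → f y ≡ v → firstPos f v n ≤ y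
firstPos-least f v zero    y       1≤y _  = 1≤y
firstPos-least f v (suc n) (suc y) 1≤y fy with f 1 ≡ᵇ v | ≡ᵇ-reflects (f 1) v | y
... | true  | _       | _      = 1≤y
... | false | ofⁿ f1≢v | zero   = contradiction fy f1≢v
... | false | ofⁿ _    | suc y′ = s≤s (firstPos-least (f ∘ suc) v n (suc y′) (s≤s z≤n) fy)

firstPos-hit : ∀ f v n → firstPos f v n ≤ n → f (firstPos f v n) ≡ v
firstPos-hit f v (suc n) le with f 1 ≡ᵇ v | ≡ᵇ-reflects (f 1) v
... | true  | ofʸ f1≡v = f1≡v
... | false | _        = firstPos-hit (f ∘ suc) v n (≤-pred le)

canonicalLabel : (ℕ → ℕ) → ℕ → ℕ
canonicalLabel f x = firstPos f (f x) x

module _ (f : ℕ → ℕ) where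

  canonicalLabel-≤ : ∀ {x} → 1 ≤ x → canonicalLabel f x ≤ x
  canonicalLabel-≤ {x} 1≤x = firstPos-least f (f x) x x 1≤x refl

  canonicalLabel-hit : ∀ {x} → 1 ≤ x → f (canonicalLabel f x) ≡ f x
  canonicalLabel-hit {x} 1≤x = firstPos-hit f (f x) x (canonicalLabel-≤ 1≤x)

  canonicalLabel-kernel : ∀ {x y} → 1 ≤ x → 1 ≤ y →
                          (f x ≡ f y) ⇔ (canonicalLabel f x ≡ canonicalLabel f y)
  canonicalLabel-kernel {x} {y} 1≤x 1≤y = mk⇔
    (λ fxy → ≤-antisym
      (firstPos-least f (f x) x _ (1≤firstPos f (f y) y) (trans (canonicalLabel-hit 1≤y) (sym fxy)))
      (firstPos-least f (f y) y _ (1≤firstPos f (f x) x) (trans (canonicalLabel-hit 1≤x) fxy)))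
    (λ cxy → trans (sym (canonicalLabel-hit 1≤x)) (trans (cong f cxy) (canonicalLabel-hit 1≤y)))

  canonicalForm : ℕ → List ℕ
  canonicalForm m = applyUpTo (canonicalLabel f ∘ suc) m

  at-canonicalForm : ∀ m x → 1 ≤ x → x ≤ m → at (canonicalForm m) x ≡ canonicalLabel f x
  at-canonicalForm m (suc x) _ x<m = at-applyUpTo (canonicalLabel f ∘ suc) m x x<m

  canonicalForm-kernel : ∀ m → SameKernelOn m (at (canonicalForm m)) f
  canonicalForm-kernel m x y 1≤x x≤m 1≤y y≤m
    rewrite at-canonicalForm m x 1≤x x≤m | at-canonicalForm m y 1≤y y≤m =
    ⇔.sym (canonicalLabel-kernel 1≤x 1≤y)

  canonicalForm-isPartition : ∀ m → IsPartition m (canonicalForm m)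
  canonicalForm-isPartition m = length-applyUpTo (canonicalLabel f ∘ suc) m , canonical
    where
    canonical : CanonicalOn m (at (canonicalForm m))
    canonical x 1≤x x≤m rewrite at-canonicalForm m x 1≤x x≤m =
      let c = canonicalLabel f x
          1≤c = 1≤firstPos f (f x) x
          c≤x = canonicalLabel-≤ 1≤x
      in 1≤c , c≤x ,
         trans (at-canonicalForm m c 1≤c (≤-trans c≤x x≤m))
               (to (canonicalLabel-kernel 1≤c 1≤x) (canonicalLabel-hit 1≤x))

-- The operations ⋆ and bar ⋆̲

m+j≰m : ∀ m {j} → 1 ≤ j → m + j ≰ m
m+j≰m m {suc j} _ = m+1+n≰m m

data Side (m n : ℕ) : ℕ → Set where
  left  : ∀ {i} → 1 ≤ i → i ≤ m → Side m n i
  right : ∀ {j} → 1 ≤ j → j ≤ n → Side m n (m + j)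

side : ∀ m n {x} → 1 ≤ x → x ≤ m + n → Side m n x
side m n {x} 1≤x x≤m+n with x ≤? m
... | yes x≤m = left 1≤x x≤m
... | no  x≰m =
  subst (Side m n) (m+[n∸m]≡n (<⇒≤ m<x)) (right (m<n⇒0<n∸m m<x) (m≤n+o⇒m∸n≤o x m x≤m+n))
  where m<x = ≰⇒> x≰m

module ⋆-Properties {m n : ℕ} (P R : List ℕ) (isP : IsPartition m P) (isR : IsPartition n R) where

  private
    f : ℕ → ℕ
    f = at (P ⋆ R)

  length-⋆ : length (P ⋆ R) ≡ m + n
  length-⋆ = trans (length-++ P) (cong₂ _+_ (proj₁ isP) (trans (length-map _ R) (proj₁ isR)))

  atˡ : ∀ {i} → 1 ≤ i → i ≤ m → f i ≡ at P i
  atˡ {suc i} _ i<m = at-++ˡ P _ i (subst (i <_) (sym (proj₁ isP)) i<m)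

  atʳ : ∀ {j} → 1 ≤ j → j ≤ n → f (m + j) ≡ m + at R j
  atʳ {suc j} _ j<n = subst (λ k → at (P ⋆ R) (k + suc j) ≡ k + at R (suc j)) (proj₁ isP) (begin
    at (P ⋆ R) (length P + suc j)     ≡⟨ cong (at (P ⋆ R)) (+-suc (length P) j) ⟩
    at (P ⋆ R) (suc (length P + j))   ≡⟨ at-++ʳ P _ j ⟩
    at (map (length P +_) R) (suc j)  ≡⟨ at-map (length P +_) R j (subst (j <_) (sym (proj₁ isR)) j<n) ⟩
    length P + at R (suc j)           ∎)
    where open ≡-Reasoning

  kernelˡ : ∀ {i i′} → 1 ≤ i → i ≤ m → 1 ≤ i′ → i′ ≤ m → (f i ≡ f i′) ⇔ (at P i ≡ at P i′)
  kernelˡ 1≤i i≤m 1≤i′ i′≤m rewrite atˡ 1≤i i≤m | atˡ 1≤i′ i′≤m = ⇔.refl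

  kernelʳ : ∀ {j j′} → 1 ≤ j → j ≤ n → 1 ≤ j′ → j′ ≤ n →
            (f (m + j) ≡ f (m + j′)) ⇔ (at R j ≡ at R j′)
  kernelʳ 1≤j j≤n 1≤j′ j′≤n rewrite atʳ 1≤j j≤n | atʳ 1≤j′ j′≤n =
    mk⇔ (+-cancelˡ-≡ m _ _) (cong (m +_))

  apart : ∀ {i j} → 1 ≤ i → i ≤ m → 1 ≤ j → j ≤ n → f i ≢ f (m + j)
  apart {i} {j} 1≤i i≤m 1≤j j≤n fij = m+j≰m m (proj₁ (proj₂ isR j 1≤j j≤n)) (begin
    m + at R j  ≡⟨ trans fij (atʳ 1≤j j≤n) ⟨
    f i         ≡⟨ atˡ 1≤i i≤m ⟩
    at P i      ≤⟨ proj₁ (proj₂ (proj₂ isP i 1≤i i≤m)) ⟩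
    i           ≤⟨ i≤m ⟩
    m           ∎)
    where open ≤-Reasoning

  isPartition : IsPartition (m + n) (P ⋆ R)
  isPartition = length-⋆ , canonical
    where
    canonical : CanonicalOn (m + n) f
    canonical x 1≤x x≤m+n with side m n 1≤x x≤m+n
    ... | left 1≤i i≤m rewrite atˡ 1≤i i≤m =
      let 1≤c , c≤i , cc = proj₂ isP _ 1≤i i≤m in
      1≤c , c≤i , trans (atˡ 1≤c (≤-trans c≤i i≤m)) cc
    ... | right 1≤j j≤n rewrite atʳ 1≤j j≤n =
      let 1≤c , c≤j , cc = proj₂ isR _ 1≤j j≤n in
      ≤-trans 1≤c (m≤n+m _ m) , +-monoʳ-≤ m c≤j , trans (atʳ 1≤c (≤-trans c≤j j≤n)) (cong (m +_) cc)

  paritySplit⇔ : ParitySplitOn (m + n) f ⇔ (ParitySplitOn m (at P) × ParitySplitOn n (at R))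
  paritySplit⇔ = mk⇔ split join
    where
    split : ParitySplitOn (m + n) f → ParitySplitOn m (at P) × ParitySplitOn n (at R)
    split ps =
      (λ x y 1≤x x≤m 1≤y y≤m Pxy → ps x y 1≤x (≤-trans x≤m (m≤m+n m n)) 1≤y (≤-trans y≤m (m≤m+n m n))
                                       (from (kernelˡ 1≤x x≤m 1≤y y≤m) Pxy)) ,
      (λ x y 1≤x x≤n 1≤y y≤n Rxy → to (parity-+ˡ m) (ps (m + x) (m + y)
        (≤-trans 1≤x (m≤n+m x m)) (+-monoʳ-≤ m x≤n) (≤-trans 1≤y (m≤n+m y m)) (+-monoʳ-≤ m y≤n)
        (from (kernelʳ 1≤x x≤n 1≤y y≤n) Rxy)))

    join : ParitySplitOn m (at P) × ParitySplitOn n (at R) → ParitySplitOn (m + n) f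
    join (psP , psR) x y 1≤x x≤ 1≤y y≤ fxy with side m n 1≤x x≤ | side m n 1≤y y≤
    ... | left 1≤i i≤m   | left 1≤i′ i′≤m  =
      psP _ _ 1≤i i≤m 1≤i′ i′≤m (to (kernelˡ 1≤i i≤m 1≤i′ i′≤m) fxy)
    ... | left 1≤i i≤m   | right 1≤j j≤n  = contradiction fxy (apart 1≤i i≤m 1≤j j≤n)
    ... | right 1≤j j≤n  | left 1≤i i≤m   = contradiction (sym fxy) (apart 1≤i i≤m 1≤j j≤n)
    ... | right 1≤j j≤n  | right 1≤j′ j′≤n =
      from (parity-+ˡ m) (psR _ _ 1≤j j≤n 1≤j′ j′≤n (to (kernelʳ 1≤j j≤n 1≤j′ j′≤n) fxy))

  nonCrossing : NonCrossing m P → NonCrossing n R → NonCrossing (m + n) (P ⋆ R)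
  nonCrossing ncP ncR a b c d 1≤a a<b b<c c<d d≤ =
    cases (side m n 1≤a a≤) (side m n 1≤b b≤) (side m n 1≤c c≤) (side m n 1≤d d≤) a<b b<c c<d
    where
    c≤ = ≤-trans (<⇒≤ c<d) d≤
    b≤ = ≤-trans (<⇒≤ b<c) c≤
    a≤ = ≤-trans (<⇒≤ a<b) b≤
    1≤b = ≤-trans 1≤a (<⇒≤ a<b)
    1≤c = ≤-trans 1≤b (<⇒≤ b<c)
    1≤d = ≤-trans 1≤c (<⇒≤ c<d)

    rightBeforeLeft : ∀ {i j} → 1 ≤ j → m + j < i → i ≤ m → ⊥
    rightBeforeLeft 1≤j m+j<i i≤m = m+j≰m m 1≤j (≤-trans (<⇒≤ m+j<i) i≤m)

    cases : ∀ {a b c d} → Side m n a → Side m n b → Side m n c → Side m n d →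
            a < b → b < c → c < d → f a ≡ f c → f b ≡ f d → f a ≡ f b
    cases (left 1≤a a≤m) _ (right 1≤c c≤n) _ _ _ _ fac _ = contradiction fac (apart 1≤a a≤m 1≤c c≤n)
    cases (right 1≤a _) _ (left _ c≤m) _ a<b b<c _ _ _ = ⊥-elim (rightBeforeLeft 1≤a (<-trans a<b b<c) c≤m)
    cases (left _ _) (right 1≤b _) (left _ c≤m) _ _ b<c _ _ _ = ⊥-elim (rightBeforeLeft 1≤b b<c c≤m)
    cases (right 1≤a _) (left _ b≤m) (right _ _) _ a<b _ _ _ _ = ⊥-elim (rightBeforeLeft 1≤a a<b b≤m)
    cases (right _ _) (right _ _) (right 1≤c _) (left _ d≤m) _ _ c<d _ _ = ⊥-elim (rightBeforeLeft 1≤c c<d d≤m)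
    cases (left 1≤a a≤m) (left 1≤b b≤m) (left 1≤c c≤m) (right 1≤d d≤n) _ _ _ _ fbd =
      contradiction fbd (apart 1≤b b≤m 1≤d d≤n)
    cases (left 1≤a a≤m) (left 1≤b b≤m) (left 1≤c c≤m) (left 1≤d d≤m) a<b b<c c<d fac fbd =
      from (kernelˡ 1≤a a≤m 1≤b b≤m)
        (ncP _ _ _ _ 1≤a a<b b<c c<d d≤m
          (to (kernelˡ 1≤a a≤m 1≤c c≤m) fac) (to (kernelˡ 1≤b b≤m 1≤d d≤m) fbd))
    cases (right 1≤a a≤n) (right 1≤b b≤n) (right 1≤c c≤n) (right 1≤d d≤n) a<b b<c c<d fac fbd =
      from (kernelʳ 1≤a a≤n 1≤b b≤n)
        (ncR _ _ _ _ 1≤a (+-cancelˡ-< m _ _ a<b) (+-cancelˡ-< m _ _ b<c) (+-cancelˡ-< m _ _ c<d) d≤n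
          (to (kernelʳ 1≤a a≤n 1≤c c≤n) fac) (to (kernelʳ 1≤b b≤n 1≤d d≤n) fbd))

  sameKernel : ∀ {g} → SameKernelOn m (at P) g → SameKernelOn n (at R) (g ∘ (m +_)) →
               (∀ {i j} → 1 ≤ i → i ≤ m → 1 ≤ j → j ≤ n → g i ≢ g (m + j)) →
               SameKernelOn (m + n) f g
  sameKernel kP kR gapart x y 1≤x x≤ 1≤y y≤ with side m n 1≤x x≤ | side m n 1≤y y≤
  ... | left 1≤i i≤m  | left 1≤i′ i′≤m  =
    ⇔.trans (kernelˡ 1≤i i≤m 1≤i′ i′≤m) (kP _ _ 1≤i i≤m 1≤i′ i′≤m)
  ... | left 1≤i i≤m  | right 1≤j j≤n  =
    mk⇔ (λ e → contradiction e (apart 1≤i i≤m 1≤j j≤n))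
        (λ e → contradiction e (gapart 1≤i i≤m 1≤j j≤n))
  ... | right 1≤j j≤n | left 1≤i i≤m   =
    mk⇔ (λ e → contradiction (sym e) (apart 1≤i i≤m 1≤j j≤n))
        (λ e → contradiction (sym e) (gapart 1≤i i≤m 1≤j j≤n))
  ... | right 1≤j j≤n | right 1≤j′ j′≤n =
    ⇔.trans (kernelʳ 1≤j j≤n 1≤j′ j′≤n) (kR _ _ 1≤j j≤n 1≤j′ j′≤n)

-- Q with a new first position in the block of its last one: bar ⋆̲ Q up to relabelling.
prependLast : List ℕ → List ℕ
prependLast Q = at Q (length Q) ∷ Q

at-prependLast-suc : ∀ Q {y} → 1 ≤ y → at (prependLast Q) (suc y) ≡ at Q y
at-prependLast-suc Q {suc y} _ = refl

joinFirst : ℕ → ℕ → ℕ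
joinFirst b y = if y ≡ᵇ b then 1 else suc y

joinFirst-view : ∀ b y → (y ≡ b × joinFirst b y ≡ 1) ⊎ (y ≢ b × joinFirst b y ≡ suc y)
joinFirst-view b y with y ≡ᵇ b | ≡ᵇ-reflects y b
... | true  | ofʸ y≡b = inj₁ (y≡b , refl)
... | false | ofⁿ y≢b = inj₂ (y≢b , refl)

joinFirst-self : ∀ b → joinFirst b b ≡ 1
joinFirst-self b with joinFirst-view b b
... | inj₁ (_ , j≡1) = j≡1
... | inj₂ (b≢b , _) = contradiction refl b≢b

joinFirst-≢ : ∀ {b y} → y ≢ b → joinFirst b y ≡ suc y
joinFirst-≢ {b} {y} y≢b with joinFirst-view b y
... | inj₁ (y≡b , _) = contradiction y≡b y≢b
... | inj₂ (_ , j≡sy) = j≡sy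

joinFirst≡1 : ∀ b {u} → u ≡ b ⊎ 1 ≤ u → joinFirst b u ≡ 1 → u ≡ b
joinFirst≡1 b (inj₁ u≡b) _ = u≡b
joinFirst≡1 b {u} (inj₂ 1≤u) j≡1 with joinFirst-view b u
... | inj₁ (u≡b , _)  = u≡b
... | inj₂ (_ , j≡su) = contradiction (suc-injective (trans (sym j≡1) j≡su)) (<⇒≢ 1≤u)

-- The hypotheses exclude u = 0 ≢ b, which joinFirst b sends to 1 as well.
joinFirst-injective : ∀ b {u v} → u ≡ b ⊎ 1 ≤ u → v ≡ b ⊎ 1 ≤ v →
                      joinFirst b u ≡ joinFirst b v → u ≡ v
joinFirst-injective b {u} {v} hu hv e with joinFirst-view b u | joinFirst-view b v
... | inj₁ (u≡b , ju) | _               = trans u≡b (sym (joinFirst≡1 b hv (trans (sym e) ju)))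
... | _               | inj₁ (v≡b , jv) = trans (joinFirst≡1 b hu (trans e jv)) (sym v≡b)
... | inj₂ (_ , ju)   | inj₂ (_ , jv)   = suc-injective (trans (sym ju) (trans e jv))

last-bar⋆ : ∀ x xs → last (bar ⋆ (x ∷ xs)) ≡ just (suc (at (x ∷ xs) (suc (length xs))))
last-bar⋆ x []       = refl
last-bar⋆ x (y ∷ ys) = last-bar⋆ y ys

bar⋆̲-∷ : ∀ x xs → bar ⋆̲ (x ∷ xs) ≡ 1 ∷ map (joinFirst (at (x ∷ xs) (suc (length xs)))) (x ∷ xs)
bar⋆̲-∷ x xs with last (bar ⋆ (x ∷ xs)) | last-bar⋆ x xs
... | _ | refl = cong₂ _∷_ (if-eta (0 ≡ᵇ at (x ∷ xs) (suc (length xs)))) (sym (map-∘ (x ∷ xs)))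

length-bar⋆̲ : ∀ Q → length (bar ⋆̲ Q) ≡ suc (length Q)
length-bar⋆̲ []       = refl
length-bar⋆̲ (x ∷ xs) rewrite bar⋆̲-∷ x xs = cong suc (length-map _ (x ∷ xs))

at-bar⋆̲ : ∀ Q x → 1 ≤ x → x ≤ suc (length Q) →
          at (bar ⋆̲ Q) x ≡ joinFirst (at Q (length Q)) (at (prependLast Q) x)
at-bar⋆̲ []       (suc zero)    _ _ = refl
at-bar⋆̲ (q ∷ qs) (suc zero)    _ _ rewrite bar⋆̲-∷ q qs = sym (joinFirst-self _)
at-bar⋆̲ []       (suc (suc _)) _ (s≤s ())
at-bar⋆̲ (q ∷ qs) (suc (suc j)) _ (s≤s j<) rewrite bar⋆̲-∷ q qs = at-map _ (q ∷ qs) j j<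

prependLast-first≡last : ∀ Q → at (prependLast Q) 1 ≡ at (prependLast Q) (suc (length Q))
prependLast-first≡last []      = refl
prependLast-first≡last (_ ∷ _) = refl

nonCrossing-prependLast : ∀ {l Q} → length Q ≡ l → NonCrossing l Q → NonCrossing (suc l) (prependLast Q)
nonCrossing-prependLast {Q = Q} refl ncQ
  (suc zero) (suc (suc b)) (suc (suc c)) (suc (suc d)) _ _ (s≤s b<c) (s≤s c<d) (s≤s d≤l) gac gbd
  with m≤n⇒m<n∨m≡n d≤l
... | inj₂ d≡l = trans (cong (at Q) (sym d≡l)) (sym gbd)
... | inj₁ d<l =
  trans gac (sym (ncQ (suc b) (suc c) (suc d) (length Q) (s≤s z≤n) b<c c<d d<l ≤-refl gbd (sym gac)))
nonCrossing-prependLast refl _ (suc zero) (suc zero) _ _ _ (s≤s ()) _ _ _ _ _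
nonCrossing-prependLast refl ncQ
  (suc (suc a)) (suc (suc b)) (suc (suc c)) (suc (suc d)) _ (s≤s a<b) (s≤s b<c) (s≤s c<d) (s≤s d≤l) gac gbd =
  ncQ (suc a) (suc b) (suc c) (suc d) (s≤s z≤n) a<b b<c c<d d≤l gac gbd

paritySplit-prependLast : ∀ {l Q} → length Q ≡ l →
  ParitySplitOn (suc l) (at (prependLast Q)) ⇔ (ParitySplitOn l (at Q) × parity l ≡ 0ℙ)
paritySplit-prependLast {Q = Q} refl = mk⇔ split join
  where
  l = length Q
  g = at (prependLast Q)

  split : ParitySplitOn (suc l) g → ParitySplitOn l (at Q) × parity l ≡ 0ℙ
  split ps =
    (λ x y 1≤x x≤l 1≤y y≤l Qxy → to (parity-+ˡ 1 {x} {y})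
      (ps (suc x) (suc y) (s≤s z≤n) (s≤s x≤l) (s≤s z≤n) (s≤s y≤l)
        (trans (at-prependLast-suc Q 1≤x) (trans Qxy (sym (at-prependLast-suc Q 1≤y)))))) ,
    sym (to (parity-+ˡ 1 {0} {l})
      (ps 1 (suc l) ≤-refl (s≤s z≤n) (s≤s z≤n) ≤-refl (prependLast-first≡last Q)))

  first-vs : ParitySplitOn l (at Q) → parity l ≡ 0ℙ → ∀ {y} → suc y ≤ l →
             g 1 ≡ g (suc (suc y)) → parity 1 ≡ parity (suc (suc y))
  first-vs psQ even {y} y<l e =
    from (parity-+ˡ 1 {0} {suc y})
      (trans (sym even) (psQ l _ (≤-trans (s≤s z≤n) y<l) ≤-refl (s≤s z≤n) y<l e))

  join : ParitySplitOn l (at Q) × parity l ≡ 0ℙ → ParitySplitOn (suc l) g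
  join _           (suc zero)    (suc zero)    _ _         _ _         _ = refl
  join (psQ , even) (suc zero)    (suc (suc y)) _ _         _ (s≤s y<l) e = first-vs psQ even y<l e
  join (psQ , even) (suc (suc x)) (suc zero)    _ (s≤s x<l) _ _         e = sym (first-vs psQ even x<l (sym e))
  join (psQ , _)   (suc (suc x)) (suc (suc y)) _ (s≤s x<l) _ (s≤s y<l) e =
    from (parity-+ˡ 1 {suc x} {suc y}) (psQ (suc x) (suc y) (s≤s z≤n) x<l (s≤s z≤n) y<l e)

sameKernel-prependLast : ∀ {l Q h} → length Q ≡ l → SameKernelOn l (at Q) (h ∘ suc) → h 1 ≡ h (suc l) →
                         SameKernelOn (suc l) (at (prependLast Q)) h
sameKernel-prependLast {Q = Q} {h} refl kQ h1≡hl = kernel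
  where
  first-vs : ∀ {y} → 1 ≤ y → y ≤ length Q → (at Q (length Q) ≡ at Q y) ⇔ (h 1 ≡ h (suc y))
  first-vs 1≤y y≤l =
    ⇔.trans (kQ _ _ (≤-trans 1≤y y≤l) ≤-refl 1≤y y≤l) (mk⇔ (trans h1≡hl) (trans (sym h1≡hl)))

  kernel : SameKernelOn (suc (length Q)) (at (prependLast Q)) h
  kernel (suc zero)    (suc zero)    _ _         _ _         = mk⇔ (λ _ → refl) (λ _ → refl)
  kernel (suc zero)    (suc (suc y)) _ _         _ (s≤s y<l) = first-vs (s≤s z≤n) y<l
  kernel (suc (suc x)) (suc zero)    _ (s≤s x<l) _ _         =
    ⇔.trans ≡-sym⇔ (⇔.trans (first-vs (s≤s z≤n) x<l) ≡-sym⇔)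
  kernel (suc (suc x)) (suc (suc y)) _ (s≤s x<l) _ (s≤s y<l) = kQ (suc x) (suc y) (s≤s z≤n) x<l (s≤s z≤n) y<l

module bar⋆̲-Properties {l : ℕ} (Q : List ℕ) (isQ : IsPartition l Q) where

  private
    b : ℕ
    b = at Q (length Q)

    x≤1+l : ∀ {x} → x ≤ suc l → x ≤ suc (length Q)
    x≤1+l {x} = subst (λ k → x ≤ suc k) (sym (proj₁ isQ))

    at-bar⋆̲-first : at (bar ⋆̲ Q) 1 ≡ 1
    at-bar⋆̲-first = trans (at-bar⋆̲ Q 1 ≤-refl (s≤s z≤n)) (joinFirst-self b)

    label-view : ∀ x → 1 ≤ x → x ≤ suc l → at (prependLast Q) x ≡ b ⊎ 1 ≤ at (prependLast Q) x
    label-view (suc zero)    _ _          = inj₁ refl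
    label-view (suc (suc j)) _ (s≤s j<l) = inj₂ (proj₁ (proj₂ isQ (suc j) (s≤s z≤n) j<l))

  isPartition : IsPartition (suc l) (bar ⋆̲ Q)
  isPartition = trans (length-bar⋆̲ Q) (cong suc (proj₁ isQ)) , canonical
    where
    canonical : CanonicalOn (suc l) (at (bar ⋆̲ Q))
    canonical (suc zero) _ _ rewrite at-bar⋆̲-first = ≤-refl , ≤-refl , at-bar⋆̲-first
    canonical (suc (suc j)) _ sj≤l rewrite at-bar⋆̲ Q (suc (suc j)) (s≤s z≤n) (x≤1+l sj≤l)
      with proj₂ isQ (suc j) (s≤s z≤n) (≤-pred sj≤l) | joinFirst-view b (at Q (suc j))
    ... | _ | inj₁ (_ , j≡1) rewrite j≡1 = ≤-refl , s≤s z≤n , at-bar⋆̲-first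
    ... | 1≤c , c≤sj , cc | inj₂ (c≢b , j≡sc) rewrite j≡sc =
      s≤s z≤n , s≤s c≤sj , (begin
        at (bar ⋆̲ Q) (suc c)                      ≡⟨ at-bar⋆̲ Q (suc c) (s≤s z≤n) (x≤1+l (s≤s c≤l)) ⟩
        joinFirst b (at (prependLast Q) (suc c))  ≡⟨ cong (joinFirst b) (trans (at-prependLast-suc Q 1≤c) cc) ⟩
        joinFirst b c                              ≡⟨ joinFirst-≢ c≢b ⟩
        suc c                                      ∎)
      where
      open ≡-Reasoning
      c = at Q (suc j)
      c≤l = ≤-trans c≤sj (≤-pred sj≤l)

  kernel : SameKernelOn (suc l) (at (bar ⋆̲ Q)) (at (prependLast Q))
  kernel x y 1≤x x≤ 1≤y y≤ rewrite at-bar⋆̲ Q x 1≤x (x≤1+l x≤) | at-bar⋆̲ Q y 1≤y (x≤1+l y≤) =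
    mk⇔ (joinFirst-injective b (label-view x 1≤x x≤) (label-view y 1≤y y≤)) (cong (joinFirst b))

  nonCrossing : NonCrossing l Q → NonCrossing (suc l) (bar ⋆̲ Q)
  nonCrossing ncQ = nonCrossing-transfer (sameKernel-sym kernel) (nonCrossing-prependLast (proj₁ isQ) ncQ)

  paritySplit⇔ : ParitySplitOn (suc l) (at (bar ⋆̲ Q)) ⇔ (ParitySplitOn l (at Q) × parity l ≡ 0ℙ)
  paritySplit⇔ = ⇔.trans (mk⇔ (paritySplit-transfer kernel) (paritySplit-transfer (sameKernel-sym kernel)))
                         (paritySplit-prependLast (proj₁ isQ))

-- The map φ

size-node : ∀ s t → size s + suc (size t) ≡ size (node s t)
size-node s t = +-suc (size s) (size t)

mutual
  isPartition-φ : ∀ τ → IsPartition (size τ) (φ τ)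
  isPartition-φ leaf       = refl , λ { _ (s≤s _) () }
  isPartition-φ (node s t) = subst (λ k → IsPartition k (φ (node s t))) (size-node s t)
    (⋆-Properties.isPartition (φ s) (bar ⋆̲ φ t) (isPartition-φ s) (isPartition-bar⋆̲φ t))

  isPartition-bar⋆̲φ : ∀ t → IsPartition (suc (size t)) (bar ⋆̲ φ t)
  isPartition-bar⋆̲φ t = bar⋆̲-Properties.isPartition (φ t) (isPartition-φ t)

nonCrossing-φ : ∀ τ → NonCrossing (size τ) (φ τ)
nonCrossing-φ leaf       _ _ _ _ _ _ _ c<d d≤0 = contradiction (<-≤-trans c<d d≤0) λ ()
nonCrossing-φ (node s t) = subst (λ k → NonCrossing k (φ (node s t))) (size-node s t)
  (⋆-Properties.nonCrossing (φ s) (bar ⋆̲ φ t) (isPartition-φ s) (isPartition-bar⋆̲φ t)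
    (nonCrossing-φ s) (bar⋆̲-Properties.nonCrossing (φ t) (isPartition-φ t) (nonCrossing-φ t)))

paritySplit-φ-node : ∀ s t → ParitySplitOn (size (node s t)) (at (φ (node s t))) ⇔
  (ParitySplitOn (size s) (at (φ s)) × ParitySplitOn (size t) (at (φ t)) × parity (size t) ≡ 0ℙ)
paritySplit-φ-node s t = subst (λ k → ParitySplitOn k (at (φ (node s t))) ⇔ Parts) (size-node s t)
  (⇔.trans (⋆-Properties.paritySplit⇔ (φ s) (bar ⋆̲ φ t) (isPartition-φ s) (isPartition-bar⋆̲φ t))
           (⇔.refl ×-⇔ bar⋆̲-Properties.paritySplit⇔ (φ t) (isPartition-φ t)))
  where
  Parts = ParitySplitOn (size s) (at (φ s)) × ParitySplitOn (size t) (at (φ t)) × parity (size t) ≡ 0ℙ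

paritySplit-φ⇔Yb : ∀ τ → ParitySplitOn (size τ) (at (φ τ)) ⇔ Yb τ
paritySplit-φ⇔Yb leaf       = mk⇔ (λ _ → inj₁ (0 , be-leaf)) (λ { _ _ _ (s≤s _) () })
paritySplit-φ⇔Yb (node s t) =
  ⇔.trans (paritySplit-φ-node s t)
    (⇔.trans (paritySplit-φ⇔Yb s ×-⇔ paritySplit-φ⇔Yb t ×-⇔ ⇔.refl) (⇔.sym (Yb-node s t)))

nonCrossing-≤ : ∀ {m n f} → m ≤ n → NonCrossingOn n f → NonCrossingOn m f
nonCrossing-≤ m≤n = nonCrossing-∘ (λ x → x) (λ x<y → x<y) (λ 1≤x → 1≤x) (λ x≤m → ≤-trans x≤m m≤n)

nonCrossing-drop : ∀ p {q f} → NonCrossingOn (suc (p + q)) f → NonCrossingOn q (λ j → f (p + suc j))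
nonCrossing-drop p {q} = nonCrossing-∘ (λ j → p + suc j) (λ x<y → +-monoʳ-< p (s≤s x<y))
  (λ {x} _ → ≤-trans (s≤s z≤n) (m≤n+m (suc x) p))
  (λ x≤q → ≤-trans (+-monoʳ-≤ p (s≤s x≤q)) (≤-reflexive (+-suc p q)))

lastBlockStart : ∀ m f → ∃[ p ] ∃[ q ] (m ≡ p + q × f (suc p) ≡ f (suc m) ×
                                        (∀ {y} → 1 ≤ y → f y ≡ f (suc m) → suc p ≤ y))
lastBlockStart m f = start (firstPos-least f (f (suc m)) (suc m)) (firstPos-hit f (f (suc m)) (suc m))
                           (1≤firstPos f (f (suc m)) (suc m))
  where
  start : ∀ {a} → (∀ y → 1 ≤ y → f y ≡ f (suc m) → a ≤ y) → (a ≤ suc m → f a ≡ f (suc m)) → 1 ≤ a →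
          ∃[ p ] ∃[ q ] (m ≡ p + q × f (suc p) ≡ f (suc m) × (∀ {y} → 1 ≤ y → f y ≡ f (suc m) → suc p ≤ y))
  start {suc p} least hit _ =
    let p≤m = ≤-pred (least (suc m) (s≤s z≤n) refl) in
    p , m ∸ p , sym (m+[n∸m]≡n p≤m) , hit (s≤s p≤m) , λ {y} → least y

-- Cutting [1, 1 + p + q] at the first position 1 + p of the block of the last position:
-- by non-crossing no block meets both sides.
module Realise (s t : Tree) {f : ℕ → ℕ} (nc : NonCrossingOn (suc (size s + size t)) f)
  (hit : f (suc (size s)) ≡ f (suc (size s + size t)))
  (first : ∀ {y} → 1 ≤ y → f y ≡ f (suc (size s + size t)) → suc (size s) ≤ y) where

  private
    p q : ℕ
    p = size s
    q = size t

  outsideLastBlock : ∀ {i} → 1 ≤ i → i ≤ p → f i ≢ f (suc (p + q))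
  outsideLastBlock 1≤i i≤p e = ≤⇒≯ i≤p (first 1≤i e)

  apart : ∀ {i j} → 1 ≤ i → i ≤ p → 1 ≤ j → j ≤ suc q → f i ≢ f (p + j)
  apart {i} {suc zero} 1≤i i≤p _ _ e = outsideLastBlock 1≤i i≤p (trans e (trans (cong f (+-comm p 1)) hit))
  apart {i} {suc (suc j)} 1≤i i≤p _ ssj≤sq e with m≤n⇒m<n∨m≡n ssj≤sq
  ... | inj₂ ssj≡sq = outsideLastBlock 1≤i i≤p (trans e (cong f (trans (cong (p +_) ssj≡sq) (+-suc p q))))
  ... | inj₁ ssj<sq =
    outsideLastBlock 1≤i i≤p
      (trans (nc i (suc p) (p + suc (suc j)) (suc (p + q)) 1≤i (s≤s i≤p) root<c c<last ≤-refl e hit) hit)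
    where
    root<c : suc p < p + suc (suc j)
    root<c = subst (_< p + suc (suc j)) (+-comm p 1) (+-monoʳ-< p (s≤s (s≤s z≤n)))
    c<last : p + suc (suc j) < suc (p + q)
    c<last = subst (p + suc (suc j) <_) (+-suc p q) (+-monoʳ-< p ssj<sq)

  kernel : SameKernelOn p (at (φ s)) f → SameKernelOn q (at (φ t)) (λ j → f (p + suc j)) →
           SameKernelOn (size (node s t)) (at (φ (node s t))) f
  kernel ks kt = subst (λ k → SameKernelOn k (at (φ (node s t))) f) (size-node s t)
    (⋆-Properties.sameKernel (φ s) (bar ⋆̲ φ t) (isPartition-φ s) (isPartition-bar⋆̲φ t) ks kR apart)
    where
    ends : f (p + 1) ≡ f (p + suc q)
    ends = trans (cong f (+-comm p 1)) (trans hit (cong f (sym (+-suc p q))))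

    kR : SameKernelOn (suc q) (at (bar ⋆̲ φ t)) (λ j → f (p + j))
    kR = sameKernel-trans (bar⋆̲-Properties.kernel (φ t) (isPartition-φ t))
                          (sameKernel-prependLast (proj₁ (isPartition-φ t)) kt ends)

Realisable : ℕ → (ℕ → ℕ) → Set
Realisable m f = ∃[ τ ] (size τ ≡ m × SameKernelOn m (at (φ τ)) f)

realise : ∀ m f → NonCrossingOn m f → Realisable m f
realise = <-rec (λ m → ∀ f → NonCrossingOn m f → Realisable m f) step
  where
  step : ∀ m → (∀ {k} → k < m → ∀ f → NonCrossingOn k f → Realisable k f) →
         ∀ f → NonCrossingOn m f → Realisable m f
  step zero    _   _ _  = leaf , refl , λ { _ _ (s≤s _) () }
  step (suc m) rec f nc with lastBlockStart m f
  ... | p , q , refl , hit , first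
    with rec (s≤s (m≤m+n p q)) f (nonCrossing-≤ (m≤n⇒m≤1+n (m≤m+n p q)) nc)
       | rec (s≤s (m≤n+m q p)) (λ j → f (p + suc j)) (nonCrossing-drop p nc)
  ...   | s , refl , ks | t , refl , kt = node s t , refl , Realise.kernel s t nc hit first ks kt

-- The interleaving Q₁ ∪ₚ Q₂

-- The positions 2i - 1 and 2i of Q₁ ∪ₚ Q₂ that carry Q₁ i and Q₂ i.
oddPos evenPos : ℕ → ℕ
oddPos zero    = 0
oddPos (suc i) = suc (i + i)
evenPos i = i + i

2*n≡n+n : ∀ n → 2 * n ≡ n + n
2*n≡n+n n = cong (n +_) (+-identityʳ n)

2*n∸1≡oddPos : ∀ n → 2 * n ∸ 1 ≡ oddPos n
2*n∸1≡oddPos zero    = refl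
2*n∸1≡oddPos (suc n) = trans (cong (_∸ 1) (2*n≡n+n (suc n))) (+-suc n n)

n+n-injective : ∀ {m n} → m + m ≡ n + n → m ≡ n
n+n-injective {m} {n} e = trans (n≡⌊n+n/2⌋ m) (trans (cong ⌊_/2⌋ e) (sym (n≡⌊n+n/2⌋ n)))

strictMono⇒injective : ∀ {e : ℕ → ℕ} → (∀ {x y} → x < y → e x < e y) → ∀ {x y} → e x ≡ e y → x ≡ y
strictMono⇒injective mono {x} {y} ex≡ey with <-cmp x y
... | tri< x<y _ _ = contradiction ex≡ey (<⇒≢ (mono x<y))
... | tri≈ _ x≡y _ = x≡y
... | tri> _ _ y<x = contradiction (sym ex≡ey) (<⇒≢ (mono y<x))

oddPos-mono-< : ∀ {x y} → x < y → oddPos x < oddPos y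
oddPos-mono-< {zero}  {suc y} _         = s≤s z≤n
oddPos-mono-< {suc x} {suc y} (s≤s x<y) = s≤s (+-mono-< x<y x<y)

evenPos-mono-< : ∀ {x y} → x < y → evenPos x < evenPos y
evenPos-mono-< x<y = +-mono-< x<y x<y

oddPos≤evenPos : ∀ x → oddPos x ≤ evenPos x
oddPos≤evenPos zero    = z≤n
oddPos≤evenPos (suc x) = s≤s (+-monoʳ-≤ x (n≤1+n x))

1≤oddPos : ∀ {x} → 1 ≤ x → 1 ≤ oddPos x
1≤oddPos {suc x} _ = s≤s z≤n

1≤evenPos : ∀ {x} → 1 ≤ x → 1 ≤ evenPos x
1≤evenPos {suc x} _ = s≤s z≤n

parity-oddPos : ∀ {x} → 1 ≤ x → parity (oddPos x) ≡ 1ℙ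
parity-oddPos {suc x} _ = parity-1+double x

parity-oddPos≢evenPos : ∀ {x} y → 1 ≤ x → parity (oddPos x) ≢ parity (evenPos y)
parity-oddPos≢evenPos y 1≤x e = contradiction (trans (sym (parity-oddPos 1≤x)) (trans e (parity-double y))) λ ()

oddPos-mono-≤ : ∀ {x y} → x ≤ y → oddPos x ≤ oddPos y
oddPos-mono-≤ {zero}  _         = z≤n
oddPos-mono-≤ {suc x} (s≤s x≤y) = s≤s (+-mono-≤ x≤y x≤y)

data Half (n : ℕ) : ℕ → Set where
  odd  : ∀ {i} → 1 ≤ i → i ≤ n → Half n (oddPos i)
  even : ∀ {i} → 1 ≤ i → i ≤ n → Half n (evenPos i)

halve : ∀ x → (∃[ i ] x ≡ evenPos i) ⊎ (∃[ i ] x ≡ oddPos (suc i))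
halve zero    = inj₁ (0 , refl)
halve (suc x) with halve x
... | inj₁ (i , x≡2i)   = inj₂ (i , cong suc x≡2i)
... | inj₂ (i , x≡2i+1) = inj₁ (suc i , trans (cong suc x≡2i+1) (sym (+-suc (suc i) i)))

half : ∀ n {x} → 1 ≤ x → x ≤ n + n → Half n x
half n {x} 1≤x x≤ with halve x
... | inj₁ (zero , refl)  = contradiction 1≤x λ ()
... | inj₁ (suc i , refl) =
  even {i = suc i} (s≤s z≤n) (≮⇒≥ λ n<i → <⇒≱ (evenPos-mono-< {n} {suc i} n<i) x≤)
... | inj₂ (i , refl)     =
  odd {i = suc i} (s≤s z≤n) (≮⇒≥ λ n≤i → <⇒≱ (s≤s (+-mono-≤ (≤-pred n≤i) (≤-pred n≤i))) x≤)

at-∪ₚ : ∀ Q₁ Q₂ → length Q₁ ≡ length Q₂ → ∀ {i} → 1 ≤ i → i ≤ length Q₁ →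
         at (Q₁ ∪ₚ Q₂) (oddPos i) ≡ oddPos (at Q₁ i) × at (Q₁ ∪ₚ Q₂) (evenPos i) ≡ evenPos (at Q₂ i)
at-∪ₚ (a ∷ _)  (b ∷ _)  _   {suc zero}    _ _         = 2*n∸1≡oddPos a , 2*n≡n+n b
at-∪ₚ (_ ∷ Q₁) (_ ∷ Q₂) len {suc (suc i)} _ (s≤s i<) rewrite +-suc i i | +-suc i (suc i) =
  at-∪ₚ Q₁ Q₂ (suc-injective len) (s≤s z≤n) i<

length-∪ₚ : ∀ Q₁ Q₂ → length Q₁ ≡ length Q₂ → length (Q₁ ∪ₚ Q₂) ≡ length Q₁ + length Q₁
length-∪ₚ []       []       _   = refl
length-∪ₚ (_ ∷ Q₁) (_ ∷ Q₂) len =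
  cong suc (trans (cong suc (length-∪ₚ Q₁ Q₂ (suc-injective len))) (sym (+-suc _ _)))

module ∪ₚ-Properties {n : ℕ} (Q₁ Q₂ : List ℕ) (isQ₁ : IsPartition n Q₁) (isQ₂ : IsPartition n Q₂) where

  private
    i≤length : ∀ {i} → i ≤ n → i ≤ length Q₁
    i≤length {i} = subst (i ≤_) (sym (proj₁ isQ₁))

    same-length = trans (proj₁ isQ₁) (sym (proj₁ isQ₂))

  at-odd : ∀ {i} → 1 ≤ i → i ≤ n → at (Q₁ ∪ₚ Q₂) (oddPos i) ≡ oddPos (at Q₁ i)
  at-odd 1≤i i≤n = proj₁ (at-∪ₚ Q₁ Q₂ same-length 1≤i (i≤length i≤n))

  at-even : ∀ {i} → 1 ≤ i → i ≤ n → at (Q₁ ∪ₚ Q₂) (evenPos i) ≡ evenPos (at Q₂ i)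
  at-even 1≤i i≤n = proj₂ (at-∪ₚ Q₁ Q₂ same-length 1≤i (i≤length i≤n))

  isPartition : IsPartition (n + n) (Q₁ ∪ₚ Q₂)
  isPartition = trans (length-∪ₚ Q₁ Q₂ same-length) (cong₂ _+_ (proj₁ isQ₁) (proj₁ isQ₁)) , canonical
    where
    canonical : CanonicalOn (n + n) (at (Q₁ ∪ₚ Q₂))
    canonical x 1≤x x≤ with half n 1≤x x≤
    ... | odd 1≤i i≤n rewrite at-odd 1≤i i≤n =
      let 1≤c , c≤i , cc = proj₂ isQ₁ _ 1≤i i≤n in
      1≤oddPos 1≤c , oddPos-mono-≤ c≤i , trans (at-odd 1≤c (≤-trans c≤i i≤n)) (cong oddPos cc)
    ... | even 1≤i i≤n rewrite at-even 1≤i i≤n =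
      let 1≤c , c≤i , cc = proj₂ isQ₂ _ 1≤i i≤n in
      1≤evenPos 1≤c , +-mono-≤ c≤i c≤i , trans (at-even 1≤c (≤-trans c≤i i≤n)) (cong evenPos cc)

  parity-label : ∀ {x} → 1 ≤ x → x ≤ n + n → parity (at (Q₁ ∪ₚ Q₂) x) ≡ parity x
  parity-label 1≤x x≤ with half n 1≤x x≤
  ... | odd 1≤i i≤n rewrite at-odd 1≤i i≤n =
    trans (parity-oddPos (proj₁ (proj₂ isQ₁ _ 1≤i i≤n))) (sym (parity-oddPos 1≤i))
  ... | even {i} 1≤i i≤n rewrite at-even 1≤i i≤n = trans (parity-double (at Q₂ i)) (sym (parity-double i))

  paritySplit : ParitySplitOn (n + n) (at (Q₁ ∪ₚ Q₂))
  paritySplit x y 1≤x x≤ 1≤y y≤ e =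
    trans (sym (parity-label 1≤x x≤)) (trans (cong parity e) (parity-label 1≤y y≤))

module Deinterleave {n : ℕ} (P : List ℕ) (ncpP : IsNCP (n + n) P) (psP : ParitySplitOn (n + n) (at P)) where

  Q₁ Q₂ : List ℕ
  Q₁ = canonicalForm (at P ∘ oddPos) n
  Q₂ = canonicalForm (at P ∘ evenPos) n

  isNCP₁ : IsNCP n Q₁
  isNCP₁ = canonicalForm-isPartition (at P ∘ oddPos) n ,
    nonCrossing-transfer (sameKernel-sym (canonicalForm-kernel (at P ∘ oddPos) n))
      (nonCrossing-∘ oddPos oddPos-mono-< 1≤oddPos (λ {x} x≤n → ≤-trans (oddPos≤evenPos x) (+-mono-≤ x≤n x≤n))
        (proj₂ ncpP))

  isNCP₂ : IsNCP n Q₂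
  isNCP₂ = canonicalForm-isPartition (at P ∘ evenPos) n ,
    nonCrossing-transfer (sameKernel-sym (canonicalForm-kernel (at P ∘ evenPos) n))
      (nonCrossing-∘ evenPos evenPos-mono-< 1≤evenPos (λ x≤n → +-mono-≤ x≤n x≤n) (proj₂ ncpP))

  private
    module ∪ = ∪ₚ-Properties Q₁ Q₂ (proj₁ isNCP₁) (proj₁ isNCP₂)

    1≤label₁ : ∀ {i} → 1 ≤ i → i ≤ n → 1 ≤ at Q₁ i
    1≤label₁ 1≤i i≤n = proj₁ (proj₂ (proj₁ isNCP₁) _ 1≤i i≤n)

  kernel : SameKernelOn (n + n) (at P) (at (Q₁ ∪ₚ Q₂))
  kernel x y 1≤x x≤ 1≤y y≤ with half n 1≤x x≤ | half n 1≤y y≤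
  ... | odd 1≤i i≤n | odd 1≤j j≤n rewrite ∪.at-odd 1≤i i≤n | ∪.at-odd 1≤j j≤n =
    ⇔.trans (⇔.sym (canonicalForm-kernel (at P ∘ oddPos) n _ _ 1≤i i≤n 1≤j j≤n))
            (mk⇔ (cong oddPos) (strictMono⇒injective oddPos-mono-<))
  ... | even 1≤i i≤n | even 1≤j j≤n rewrite ∪.at-even 1≤i i≤n | ∪.at-even 1≤j j≤n =
    ⇔.trans (⇔.sym (canonicalForm-kernel (at P ∘ evenPos) n _ _ 1≤i i≤n 1≤j j≤n))
            (mk⇔ (cong evenPos) (strictMono⇒injective evenPos-mono-<))
  ... | odd 1≤i i≤n | even {j} 1≤j j≤n rewrite ∪.at-odd 1≤i i≤n | ∪.at-even 1≤j j≤n =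
    mk⇔ (λ e → contradiction (psP _ _ 1≤x x≤ 1≤y y≤ e) (parity-oddPos≢evenPos j 1≤i))
        (λ e → contradiction (cong parity e) (parity-oddPos≢evenPos (at Q₂ j) (1≤label₁ 1≤i i≤n)))
  ... | even {i} 1≤i i≤n | odd 1≤j j≤n rewrite ∪.at-even 1≤i i≤n | ∪.at-odd 1≤j j≤n =
    mk⇔ (λ e → contradiction (sym (psP _ _ 1≤x x≤ 1≤y y≤ e)) (parity-oddPos≢evenPos i 1≤j))
        (λ e → contradiction (cong parity (sym e)) (parity-oddPos≢evenPos (at Q₂ i) (1≤label₁ 1≤j j≤n)))

  P≡Q₁∪Q₂ : P ≡ Q₁ ∪ₚ Q₂
  P≡Q₁∪Q₂ = partition-unique (proj₁ ncpP) ∪.isPartition kernel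

Yb⇒Ybe : ∀ {n τ} → Yb τ → size τ ≡ n + n → Ybe n τ
Yb⇒Ybe {τ = τ} (inj₁ (_ , e)) size≡ =
  subst (λ k → Ybe k τ) (n+n-injective (trans (sym (size-Ybe e)) size≡)) e
Yb⇒Ybe {n}     (inj₂ (_ , o)) size≡ =
  contradiction (trans (sym (parity-Ybo o)) (trans (cong parity size≡) (parity-double n))) λ ()

φ-Ybe⇒∪ₚ : ∀ {n τ} → Ybe n τ →
  IsNCP (2 * n) (φ τ) × ∃[ Q₁ ] ∃[ Q₂ ] (IsNCP n Q₁ × IsNCP n Q₂ × φ τ ≡ Q₁ ∪ₚ Q₂)
φ-Ybe⇒∪ₚ {n} {τ} e =
  subst (λ k → IsNCP k (φ τ)) (sym (2*n≡n+n n)) ncp , Q₁ , Q₂ , isNCP₁ , isNCP₂ , P≡Q₁∪Q₂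
  where
  ncp : IsNCP (n + n) (φ τ)
  ncp = subst (λ k → IsNCP k (φ τ)) (size-Ybe e) (isPartition-φ τ , nonCrossing-φ τ)

  ps : ParitySplitOn (n + n) (at (φ τ))
  ps = subst (λ k → ParitySplitOn k (at (φ τ))) (size-Ybe e) (from (paritySplit-φ⇔Yb τ) (inj₁ (n , e)))

  open Deinterleave {n} (φ τ) ncp ps

∪ₚ⇒φ-Ybe : ∀ {n} Q₁ Q₂ → IsNCP n Q₁ → IsNCP n Q₂ → IsNCP (2 * n) (Q₁ ∪ₚ Q₂) →
           ∃[ τ ] (Ybe n τ × φ τ ≡ Q₁ ∪ₚ Q₂)
∪ₚ⇒φ-Ybe {n} Q₁ Q₂ ncp₁ ncp₂ ncp
  with realise (n + n) (at (Q₁ ∪ₚ Q₂)) (subst (λ k → NonCrossing k (Q₁ ∪ₚ Q₂)) (2*n≡n+n n) (proj₂ ncp))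
... | τ , size≡ , kernel = τ , Yb⇒Ybe (to (paritySplit-φ⇔Yb τ) ps) size≡ , φτ≡
  where
  φτ≡ : φ τ ≡ Q₁ ∪ₚ Q₂
  φτ≡ = partition-unique (subst (λ k → IsPartition k (φ τ)) size≡ (isPartition-φ τ))
                         (subst (λ k → IsPartition k (Q₁ ∪ₚ Q₂)) (2*n≡n+n n) (proj₁ ncp)) kernel

  ps : ParitySplitOn (size τ) (at (φ τ))
  ps = subst (λ k → ParitySplitOn k (at (φ τ))) (sym size≡)
         (paritySplit-transfer (sameKernel-sym kernel)
           (∪ₚ-Properties.paritySplit Q₁ Q₂ (proj₁ ncp₁) (proj₁ ncp₂)))

lemma4p20 :
    (∀ (n : ℕ) (τ : Tree) → size τ ≡ n →
      (Splits τ ⇔ ((∃[ k ] Ybe k τ) ⊎ (∃[ k ] Ybo k τ))))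
    ×
    (∀ (n : ℕ) (P : List ℕ) →
      ((∃[ τ ] (Ybe n τ × φ τ ≡ P)) ⇔
       (IsNCP (2 * n) P × ∃[ Q₁ ] ∃[ Q₂ ] (IsNCP n Q₁ × IsNCP n Q₂ × P ≡ Q₁ ∪ₚ Q₂))))
lemma4p20 = (λ _ τ _ → splits⇔Yb τ) , λ n P → mk⇔
  (λ { (τ , e , refl) → φ-Ybe⇒∪ₚ e })
  (λ { (ncp , Q₁ , Q₂ , ncp₁ , ncp₂ , refl) → ∪ₚ⇒φ-Ybe Q₁ Q₂ ncp₁ ncp₂ ncp })
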